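{- Let $\alpha,\beta,\mu$ be partitions, $n,m,j\ge0$, $U\in\mathcal{D}(\beta/\mu)$ with $\beta/\mu\vdash 2(m-j)$, $V\in\mathcal{D}(\alpha/\mu)$ with $\alpha/\mu\vdash 2(n-j)$, $M\in\mathfrak{M}^j_{n,m}$, and let $\Phi(U,V,M)=(P,Q)$ and $\pi=cp(M)$. Then $$tc(\pi)=sp(P)+sp(Q)-sp(U)-sp(V).$$
   Context: Partitions are identified with Young diagrams (cell $(i,j)$ in row $i$, column $j$); for $\mu\subseteq\lambda$, $\lambda/\mu$ is the set of cells of $\lambda$ not in $\mu$, and $\lambda/\mu\vdash n$ means it has $n$ cells. A domino is a pair of horizontally or vertically adjacent cells. A standard domino tableau (SDT) of shape $\lambda/\mu\vdash 2n$ is a bijection $T$ from the cells of $\lambda/\mu$ to $\{1,\dots,2n\}$, weakly increasing along rows and down columns, such that the cells with entries $2k-1,2k$ form a domino for each $k$; it is viewed as dominoes labelled $1,\dots,n$. $\mathcal{D}(\lambda/\mu)$ is the set of such. For an SDT $D$, $sp(D)$ is half the number of vertical dominoes of $D$. A colored permutation of $[j]$ is a permutation with bars on some of its values; $tc(\pi)$ is the number of barred values. Its permutation matrix has $(i,k)$ entry $1$ if $\pi_i=k$, $-1$ if $\pi_i=\bar k$, $0$ otherwise. An $n\times m$ partial permutation matrix (PPM) has entries in $\{1,-1,0\}$ with at most one nonzero entry per row and column; $\mathfrak{M}^j_{n,m}$ is the set of these with exactly $j$ nonzero entries; $cp(M)$ is the colored permutation whose permutation matrix is $M$ with all zero rows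 and columns deleted. Write $\mu<_{\rm d}\lambda$ if $\lambda/\mu$ is a domino, $\mu\le_{\rm d}\lambda$ if $\mu=\lambda$ or $\mu<_{\rm d}\lambda$. The map $\Phi$: from $U,V,M$ as in the claim build partitions $\Gamma_{(i,k)}$, $0\le i\le n$, $0\le k\le m$: the top row $\Gamma_{(0,0)}\le_{\rm d}\cdots\le_{\rm d}\Gamma_{(0,m)}$ is the multichain from $\mu$ to $\beta$ with $\Gamma_{(0,k-1)}=\Gamma_{(0,k)}$ exactly when column $k$ of $M$ has a nonzero entry, its nonempty differences being the dominoes of $U$ in label order; the left column $\Gamma_{(0,0)}\le_{\rm d}\cdots\le_{\rm d}\Gamma_{(n,0)}$ is the multichain from $\mu$ to $\alpha$ with $\Gamma_{(i-1,0)}=\Gamma_{(i,0)}$ exactly when row $i$ of $M$ has a nonzero entry, its nonempty differences being the dominoes of $V$ in order. For $i,k\ge1$, with $\nu=\Gamma_{(i-1,k-1)}$, $\kappa=\Gamma_{(i-1,k)}$, $\rho=\Gamma_{(i,k-1)}$, $\Gamma_{(i,k)}$ is: (1) if $M(i,k)=1$, $\kappa$ plus a horizontal domino in row 1; (2) if $M(i,k)=-1$, $\kappa$ plus a vertical domino in column 1; (3) if $M(i,k)=0$: (a) if $\nu=\kappa$ or $\nu=\rho$, the largest of $\nu,\kappa,\rho$; (b) if $\nu<_{\rm d}\kappa,\rho$, $\kappa\neq\rho$, $\kappa/\nu\cap\rho/\nu=\emptyset$: $\kappa\cup\rho$; (c) if $\nu<_{\rm d}\kappa,\rho$, $\kappa\ne\rho$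 and $\kappa/\nu,\rho/\nu$ share a cell $(p,q)$: $\kappa\cup\rho$ plus the cell $(p+1,q+1)$; (d) if $\nu<_{\rm d}\kappa=\rho$ with $\kappa/\nu$ a horizontal domino in row $r$: $\kappa$ plus a horizontal domino in row $r+1$; (e) if $\nu<_{\rm d}\kappa=\rho$ with $\kappa/\nu$ a vertical domino in column $c$: $\kappa$ plus a vertical domino in column $c+1$. With $\lambda=\Gamma_{(n,m)}$, $P\in\mathcal{D}(\lambda/\alpha)$ has domino $k$ equal to $\Gamma_{(n,k)}/\Gamma_{(n,k-1)}$ and $Q\in\mathcal{D}(\lambda/\beta)$ has domino $i$ equal to $\Gamma_{(i,m)}/\Gamma_{(i-1,m)}$; $\Phi(U,V,M)=(P,Q)$. -}

module Defs where

open import Data.Nat using (ℕ; zero; suc; _≤_; _≥_; _≤?_)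
open import Data.Nat.Properties using ()
open import Data.Bool using (Bool; true; false; _∨_; T; if_then_else_)
open import Data.List using (List; []; _∷_; length; filter; tabulate)
open import Data.List.Relation.Unary.All using (All)
open import Data.List.Relation.Unary.Linked using (Linked)
open import Data.Fin using (Fin; inject₁; fromℕ) renaming (_<_ to _<ᶠ_; zero to fzero; suc to fsuc)
import Data.Fin as Fin
open import Data.Product using (Σ; _×_; _,_; proj₁; proj₂; ∃)
open import Data.Sum using (_⊎_)
open import Data.Integer using (+_)
open import Data.Rational using (ℚ; _/_)
open import Relation.Nullary using (¬_; yes; no)
open import Relation.Binary.PropositionalEquality using (_≡_; _≢_)
open import Function.Bundles using (_⇔_)

-- Partitions and Young diagrams (1-indexed cells (row , column))

IsPartition : List ℕ → Set
IsPartition λ′ = All (λ x → 1 ≤ x) λ′ × Linked _≥_ λ′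

Cell : Set
Cell = ℕ × ℕ

-- length of row i (1-indexed); 0 for rows that do not exist
row : List ℕ → ℕ → ℕ
row []       _             = 0
row (x ∷ xs) zero          = 0
row (x ∷ xs) (suc zero)    = x
row (x ∷ xs) (suc (suc i)) = row xs (suc i)

colLen : List ℕ → ℕ → ℕ
colLen λ′ c = length (filter (c ≤?_) λ′)

_∈ᶜ_ : Cell → List ℕ → Set
(i , j) ∈ᶜ λ′ = 1 ≤ i × 1 ≤ j × j ≤ row λ′ i

-- Dominoes, given by their top-left cell

data Domino : Set where
  hor : (r c : ℕ) → Domino
  ver : (r c : ℕ) → Domino

_∈ᵈ_ : Cell → Domino → Set
x ∈ᵈ hor r c = x ≡ (r , c) ⊎ x ≡ (r , suc c)
x ∈ᵈ ver r c = x ≡ (r , c) ⊎ x ≡ (suc r , c)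

isVertical : Domino → Bool
isVertical (hor _ _) = false
isVertical (ver _ _) = true

SkewIsDomino : List ℕ → List ℕ → Domino → Set
SkewIsDomino λ′ μ d =
  (∀ x → x ∈ᶜ μ → x ∈ᶜ λ′) × (∀ x → ((x ∈ᶜ λ′) × ¬ (x ∈ᶜ μ)) ⇔ x ∈ᵈ d)

_<d_ : List ℕ → List ℕ → Set
μ <d λ′ = Σ Domino (SkewIsDomino λ′ μ)

-- Standard domino tableaux, viewed as the dominoes labelled 1..n in order:
-- SDT μ λ (d₁ ∷ … ∷ dₙ ∷ []) says μ = γ₀ <_d γ₁ <_d … <_d γₙ = λ with
-- γₖ/γₖ₋₁ = dₖ and every γₖ a partition (equivalently: the cells of dₖ carry
-- the entries 2k-1, 2k of a standard domino tableau of shape λ/μ).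

data SDT : List ℕ → List ℕ → List Domino → Set where
  []  : ∀ {μ} → SDT μ μ []
  _∷_ : ∀ {μ ν λ′ d ds} → (IsPartition ν × SkewIsDomino ν μ d) →
        SDT ν λ′ ds → SDT μ λ′ (d ∷ ds)

vcount : List Domino → ℕ
vcount []       = 0
vcount (d ∷ ds) = if isVertical d then suc (vcount ds) else vcount ds

sp : List Domino → ℚ
sp ds = (+ vcount ds) / 2

data Entry : Set where
  zer one neg : Entry      -- 0 , 1 , -1

nzB : Entry → Bool
nzB zer = false
nzB one = true
nzB neg = true

sumFin : ∀ {n} → (Fin n → ℕ) → ℕ
sumFin {zero}  f = 0
sumFin {suc n} f = f fzero Data.Nat.+ sumFin (λ i → f (fsuc i))

anyFin : ∀ {n} → (Fin n → Bool) → Bool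
anyFin {zero}  f = false
anyFin {suc n} f = f fzero ∨ anyFin (λ i → f (fsuc i))

Matrix : ℕ → ℕ → Set
Matrix n m = Fin n → Fin m → Entry

IsPPM : ∀ {n m} → Matrix n m → Set
IsPPM M = (∀ i k k′ → M i k ≢ zer → M i k′ ≢ zer → k ≡ k′)
        × (∀ i i′ k → M i k ≢ zer → M i′ k ≢ zer → i ≡ i′)

nnz : ∀ {n m} → Matrix n m → ℕ
nnz M = sumFin (λ i → sumFin (λ k → if nzB (M i k) then 1 else 0))

PPM : ℕ → ℕ → ℕ → Set
PPM j n m = Σ (Matrix n m) (λ M → IsPPM M × nnz M ≡ j)

rowNZ : ∀ {n m} → Matrix n m → Fin n → Bool
rowNZ M i = anyFin (λ k → nzB (M i k))

colNZ : ∀ {n m} → Matrix n m → Fin m → Bool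
colNZ M k = anyFin (λ i → nzB (M i k))

-- Colored permutations of [j]: π a = (value , barred?)

ColoredPerm : ℕ → Set
ColoredPerm j = Fin j → Fin j × Bool

IsColoredPerm : ∀ {j} → ColoredPerm j → Set
IsColoredPerm π = ∀ a b → proj₁ (π a) ≡ proj₁ (π b) → a ≡ b

permEntry : ∀ {j} → ColoredPerm j → Fin j → Fin j → Entry
permEntry π a b with proj₁ (π a) Fin.≟ b
... | yes _ = if proj₂ (π a) then neg else one
... | no  _ = zer

tc : ∀ {j} → ColoredPerm j → ℕ
tc π = sumFin (λ a → if proj₂ (π a) then 1 else 0)

StrictlyIncreasing : ∀ {j n} → (Fin j → Fin n) → Set
StrictlyIncreasing r = ∀ a b → a <ᶠ b → r a <ᶠ r b

-- cp(M) = π : deleting the zero rows and columns of M (kept rows r 0 < r 1 < …,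
-- kept columns c 0 < c 1 < …) leaves the permutation matrix of π.
IsCp : ∀ {j n m} → Matrix n m → ColoredPerm j → Set
IsCp {j} {n} {m} M π =
  Σ (Fin j → Fin n) λ r → Σ (Fin j → Fin m) λ c →
    StrictlyIncreasing r × StrictlyIncreasing c
    × (∀ i → T (rowNZ M i) ⇔ ∃ (λ a → r a ≡ i))
    × (∀ k → T (colNZ M k) ⇔ ∃ (λ b → c b ≡ k))
    × (∀ a b → M (r a) (c b) ≡ permEntry π a b)

-- Multichain γ₀ ≤_d γ₁ ≤_d … : list entries (flag_k , γ_k) for k ≥ 1;
-- γ_{k-1} = γ_k exactly when flag_k = true, and the nonempty differences
-- are the given dominoes in order.
data MultiChain : List ℕ → List (Bool × List ℕ) → List Domino → Set where
  []   : ∀ {γ} → MultiChain γ [] []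
  stay : ∀ {γ rest ds} → MultiChain γ rest ds → MultiChain γ ((true , γ) ∷ rest) ds
  grow : ∀ {γ γ′ rest d ds} → SkewIsDomino γ′ γ d → MultiChain γ′ rest ds →
         MultiChain γ ((false , γ′) ∷ rest) (d ∷ ds)

data Diffs : List ℕ → List (List ℕ) → List Domino → Set where
  []  : ∀ {γ} → Diffs γ [] []
  _∷_ : ∀ {γ γ′ rest d ds} → SkewIsDomino γ′ γ d → Diffs γ′ rest ds →
        Diffs γ (γ′ ∷ rest) (d ∷ ds)

_≐_ : List ℕ → (Cell → Set) → Set
γ ≐ S = ∀ x → x ∈ᶜ γ ⇔ S x

-- local rule: Γ(i,k) = γ from ν = Γ(i-1,k-1), κ = Γ(i-1,k), ρ = Γ(i,k-1)
LocalRule : Entry → (ν κ ρ γ : List ℕ) → Set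
LocalRule one ν κ ρ γ = SkewIsDomino γ κ (hor 1 (suc (row κ 1)))
LocalRule neg ν κ ρ γ = SkewIsDomino γ κ (ver (suc (colLen κ 1)) 1)
LocalRule zer ν κ ρ γ =
    -- (a)
    (ν ≡ κ → γ ≡ ρ)
  × (ν ≡ ρ → γ ≡ κ)
    -- (b)
  × (∀ d₁ d₂ → SkewIsDomino κ ν d₁ → SkewIsDomino ρ ν d₂ → κ ≢ ρ →
       (∀ x → x ∈ᵈ d₁ → ¬ (x ∈ᵈ d₂)) →
       γ ≐ (λ x → x ∈ᶜ κ ⊎ x ∈ᶜ ρ))
    -- (c)
  × (∀ d₁ d₂ p q → SkewIsDomino κ ν d₁ → SkewIsDomino ρ ν d₂ → κ ≢ ρ →
       (p , q) ∈ᵈ d₁ → (p , q) ∈ᵈ d₂ →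
       γ ≐ (λ x → x ∈ᶜ κ ⊎ x ∈ᶜ ρ ⊎ x ≡ (suc p , suc q)))
    -- (d)
  × (∀ r c → SkewIsDomino κ ν (hor r c) → κ ≡ ρ →
       SkewIsDomino γ κ (hor (suc r) (suc (row κ (suc r)))))
    -- (e)
  × (∀ r c → SkewIsDomino κ ν (ver r c) → κ ≡ ρ →
       SkewIsDomino γ κ (ver (suc (colLen κ (suc c))) (suc c)))

-- Γ : Fin (n+1) → Fin (m+1) → partitions is the growth diagram of (U, V, M),
-- with M(i+1,k+1) (paper, 1-indexed) = M i k here.
IsGrowth : ∀ {n m} → (α β μ : List ℕ) → (U V : List Domino) → Matrix n m →
           (Fin (suc n) → Fin (suc m) → List ℕ) → Set
IsGrowth {n} {m} α β μ U V M Γ =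
    (∀ i k → IsPartition (Γ i k))
  × Γ fzero fzero ≡ μ
  × Γ fzero (fromℕ m) ≡ β
  × Γ (fromℕ n) fzero ≡ α
  × MultiChain μ (tabulate (λ (k : Fin m) → colNZ M k , Γ fzero (fsuc k))) U
  × MultiChain μ (tabulate (λ (i : Fin n) → rowNZ M i , Γ (fsuc i) fzero)) V
  × (∀ (i : Fin n) (k : Fin m) →
       LocalRule (M i k) (Γ (inject₁ i) (inject₁ k)) (Γ (inject₁ i) (fsuc k))
                 (Γ (fsuc i) (inject₁ k)) (Γ (fsuc i) (fsuc k)))

IsΦ : ∀ {n m} → (α β μ : List ℕ) → (U V : List Domino) → Matrix n m →
      (P Q : List Domino) → Set
IsΦ {n} {m} α β μ U V M P Q =
  Σ (Fin (suc n) → Fin (suc m) → List ℕ) λ Γ →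
    IsGrowth α β μ U V M Γ
    × Diffs (Γ (fromℕ n) fzero) (tabulate (λ (k : Fin m) → Γ (fromℕ n) (fsuc k))) P
    × Diffs (Γ fzero (fromℕ m)) (tabulate (λ (i : Fin n) → Γ (fsuc i) (fromℕ m))) Q

module Submission where

-- Attach to every edge of the growth diagram Γ its "vertical weight": 0 if the
-- two shapes are equal or differ by a horizontal domino, 1 if they differ by a vertical
-- one.  A case analysis of the local rules shows that around each cell, whose top edge
-- ν → κ and left edge ν → ρ have weights t and l, the bottom edge ρ → γ and the right
-- edge κ → γ have weights adding up to t + l, plus 2 when the cell carries -1
-- (local balance).  Summing the local balances over the n × m grid telescopes: the
-- weights of the bottom row plus the right column equal those of the top row plus the
-- left column plus twice the number of -1 entries of M.  The boundary rows and columns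
-- spell out U, V, P, Q, so their weights are the vertical counts of these tableaux,
-- and the -1 entries of M are exactly the barred values of cp(M).  Hence
--   #vert(P) + #vert(Q) = #vert(U) + #vert(V) + 2 tc(π),
-- and dividing by 2 gives the statement.

open import Defs

module VerticalBalance where

  open import Data.Nat using (ℕ; zero; suc; _+_; _*_; _≤_; _<_; _≥_; z≤n; s≤s; _≤?_)
  import Data.Nat as ℕ
  import Data.Nat.Properties as ℕP
  open import Data.Nat.Tactic.RingSolver using (solve-∀)
  open import Data.Bool using (Bool; true; false; T; if_then_else_)
  open import Data.Bool.Properties using (T-∨)
  open import Data.Unit using (tt)
  open import Data.List using (List; []; _∷_; tabulate)
  import Data.List.Properties as ListP
  open import Data.List.Relation.Unary.All using (All; []; _∷_)
  open import Data.List.Relation.Unary.Linked using (Linked; []; [-]; _∷_)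
  open import Data.Fin using (Fin; inject₁; fromℕ; toℕ) renaming (zero to fzero; suc to fsuc; _<_ to _<ᶠ_)
  import Data.Fin.Properties as FinP
  open import Data.Product using (Σ; _×_; _,_; proj₁; proj₂; ∃) renaming (swap to swap-×)
  import Data.Product.Properties as ProductP
  open import Data.Sum using (_⊎_; inj₁; inj₂; swap; [_,_])
  open import Data.Empty using (⊥; ⊥-elim)
  open import Function using (_∘_)
  open import Relation.Nullary using (¬_; yes; no; Dec; contradiction)
  open import Relation.Nullary.Decidable using (_×-dec_; _⊎-dec_)
  open import Relation.Binary.PropositionalEquality
    using (_≡_; _≢_; refl; sym; trans; cong; cong₂; subst; subst₂; module ≡-Reasoning)
  open import Function.Bundles using (_⇔_; mk⇔; Equivalence)
  open Equivalence using (to; from)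

  ∈ᶜ-dec : ∀ x λ′ → Dec (x ∈ᶜ λ′)
  ∈ᶜ-dec (i , c) λ′ = (1 ≤? i) ×-dec ((1 ≤? c) ×-dec (c ≤? row λ′ i))

  cell-left : ∀ {λ′ i c} → (i , suc c) ∈ᶜ λ′ → 1 ≤ c → (i , c) ∈ᶜ λ′
  cell-left (i≥1 , _ , c<row) c≥1 = i≥1 , c≥1 , ℕP.≤-trans (ℕP.n≤1+n _) c<row

  row-antitone : ∀ {λ′} → Linked _≥_ λ′ → ∀ i → 1 ≤ i → row λ′ (suc i) ≤ row λ′ i
  row-antitone []        _             _ = z≤n
  row-antitone [-]       (suc zero)    _ = z≤n
  row-antitone [-]       (suc (suc i)) _ = z≤n
  row-antitone (x≥y ∷ _) (suc zero)    _ = x≥y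
  row-antitone (_ ∷ xs)  (suc (suc i)) _ = row-antitone xs (suc i) (s≤s z≤n)

  cell-up : ∀ {λ′ i c} → IsPartition λ′ → (suc i , c) ∈ᶜ λ′ → 1 ≤ i → (i , c) ∈ᶜ λ′
  cell-up {i = i} (_ , decreasing) (_ , c≥1 , c≤row) i≥1 =
    i≥1 , c≥1 , ℕP.≤-trans c≤row (row-antitone decreasing i i≥1)

  row-mono : ∀ {a b} → (∀ x → x ∈ᶜ a → x ∈ᶜ b) → ∀ i → 1 ≤ i → row a i ≤ row b i
  row-mono {a} a⊆b i i≥1 with row a i in eq
  ... | zero  = z≤n
  ... | suc u = proj₂ (proj₂ (a⊆b (i , suc u) (i≥1 , s≤s z≤n , ℕP.≤-reflexive (sym eq))))

  rows-ext : ∀ {a b} → All (λ x → 1 ≤ x) a → All (λ x → 1 ≤ x) b →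
             (∀ i → 1 ≤ i → row a i ≡ row b i) → a ≡ b
  rows-ext []         []         _    = refl
  rows-ext []         (y≥1 ∷ _)  rows = ⊥-elim (ℕP.<⇒≢ y≥1 (rows 1 (s≤s z≤n)))
  rows-ext (x≥1 ∷ _)  []         rows = ⊥-elim (ℕP.<⇒≢ x≥1 (sym (rows 1 (s≤s z≤n))))
  rows-ext (_ ∷ as)   (_ ∷ bs)   rows =
    cong₂ _∷_ (rows 1 (s≤s z≤n)) (rows-ext as bs λ { (suc i) _ → rows (suc (suc i)) (s≤s z≤n) })

  partition-ext : ∀ {a b} → IsPartition a → IsPartition b → (∀ x → x ∈ᶜ a ⇔ x ∈ᶜ b) → a ≡ b
  partition-ext {a} {b} (a-pos , _) (b-pos , _) same = rows-ext a-pos b-pos λ i i≥1 →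
    ℕP.≤-antisym (row-mono {a} {b} (λ x → to (same x)) i i≥1)
                 (row-mono {b} {a} (λ x → from (same x)) i i≥1)

  -- κ is ν with the domino d added.  Wrapping SkewIsDomino in a record makes κ, ν and d
  -- recoverable from a proof, so they can stay implicit below.
  record Adds (κ ν : List ℕ) (d : Domino) : Set where
    constructor adds
    field skew : SkewIsDomino κ ν d

  domino-new : ∀ {κ ν d x} → Adds κ ν d → x ∈ᵈ d → x ∈ᶜ κ × ¬ x ∈ᶜ ν
  domino-new (adds (_ , new-cells)) x∈d = from (new-cells _) x∈d

  domino-fresh : ∀ {κ ν d x} → Adds κ ν d → x ∈ᶜ κ → ¬ x ∈ᶜ ν → x ∈ᵈ d
  domino-fresh (adds (_ , new-cells)) x∈κ x∉ν = to (new-cells _) (x∈κ , x∉ν)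

  adds-⊆ : ∀ {κ ν d} → Adds κ ν d → ∀ x → x ∈ᶜ ν → x ∈ᶜ κ
  adds-⊆ (adds (ν⊆κ , _)) = ν⊆κ

  new-in-both : ∀ {A B ν dA dB x} → Adds A ν dA → Adds B ν dB → x ∈ᵈ dB → x ∈ᶜ A → x ∈ᵈ dA
  new-in-both sA sB x∈dB x∈A = domino-fresh sA x∈A (proj₂ (domino-new sB x∈dB))

  corner second : Domino → Cell
  corner (hor r c) = r , c
  corner (ver r c) = r , c
  second (hor r c) = r , suc c
  second (ver r c) = suc r , c

  corner∈ : ∀ d → corner d ∈ᵈ d
  corner∈ (hor _ _) = inj₁ refl
  corner∈ (ver _ _) = inj₁ refl

  second∈ : ∀ d → second d ∈ᵈ d
  second∈ (hor _ _) = inj₂ refl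
  second∈ (ver _ _) = inj₂ refl

  cells-of : ∀ {x} d → x ∈ᵈ d → x ≡ corner d ⊎ x ≡ second d
  cells-of (hor _ _) x∈d = x∈d
  cells-of (ver _ _) x∈d = x∈d

  adds-proper : ∀ {κ ν d} → Adds κ ν d → ν ≢ κ
  adds-proper {d = d} s refl = let (∈κ , ∉ν) = domino-new s (corner∈ d) in ∉ν ∈κ

  meet? : ∀ d₁ d₂ → (∀ x → x ∈ᵈ d₁ → ¬ x ∈ᵈ d₂) ⊎ Σ Cell (λ x → x ∈ᵈ d₁ × x ∈ᵈ d₂)
  meet? d₁ d₂ with corner d₁ ∈ᵈ? d₂ | second d₁ ∈ᵈ? d₂
    where
    _≟ᶜ_ = ProductP.≡-dec ℕ._≟_ ℕ._≟_
    _∈ᵈ?_ : ∀ x d → Dec (x ∈ᵈ d)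
    x ∈ᵈ? hor r c = (x ≟ᶜ (r , c)) ⊎-dec (x ≟ᶜ (r , suc c))
    x ∈ᵈ? ver r c = (x ≟ᶜ (r , c)) ⊎-dec (x ≟ᶜ (suc r , c))
  ... | yes corner∈d₂ | _              = inj₂ (_ , corner∈ d₁ , corner∈d₂)
  ... | no  _         | yes second∈d₂  = inj₂ (_ , second∈ d₁ , second∈d₂)
  ... | no  corner∉d₂ | no  second∉d₂  = inj₁ λ x x∈d₁ →
    [ (λ { refl → corner∉d₂ }) , (λ { refl → second∉d₂ }) ] (cells-of d₁ x∈d₁)

  vweight : Domino → ℕ
  vweight d = if isVertical d then 1 else 0

  vcount-∷ : ∀ d ds → vcount (d ∷ ds) ≡ vweight d + vcount ds
  vcount-∷ (hor _ _) _ = refl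
  vcount-∷ (ver _ _) _ = refl

  vweight-unique : ∀ {κ ν d d′} → Adds κ ν d → Adds κ ν d′ → vweight d ≡ vweight d′
  vweight-unique {d = hor _ _} {hor _ _} _ _ = refl
  vweight-unique {d = ver _ _} {ver _ _} _ _ = refl
  vweight-unique {d = hor r c} {ver r′ c′} s s′ =
    ⊥-elim (hor-not-in-ver (moved (inj₁ refl)) (moved (inj₂ refl)))
    where
    moved : ∀ {x} → x ∈ᵈ hor r c → x ∈ᵈ ver r′ c′
    moved x∈d = new-in-both s′ s x∈d (proj₁ (domino-new s x∈d))
    hor-not-in-ver : (r , c) ∈ᵈ ver r′ c′ → (r , suc c) ∈ᵈ ver r′ c′ → ⊥
    hor-not-in-ver (inj₁ refl) (inj₁ ())
    hor-not-in-ver (inj₁ refl) (inj₂ ())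
    hor-not-in-ver (inj₂ refl) (inj₁ ())
    hor-not-in-ver (inj₂ refl) (inj₂ ())
  vweight-unique {d = ver r c} {hor r′ c′} s s′ = sym (vweight-unique s′ s)

  -- Weighted steps: an edge a → b of the growth diagram with its vertical weight w

  data Step (a b : List ℕ) (w : ℕ) : Set where
    stay : a ≡ b → w ≡ 0 → Step a b w
    grow : (d : Domino) → Adds b a d → w ≡ vweight d → Step a b w

  stay-weight : ∀ {a w} → Step a a w → w ≡ 0
  stay-weight (stay _ w≡0) = w≡0
  stay-weight (grow _ s _) = ⊥-elim (adds-proper s refl)

  grow-weight : ∀ {a b w d} → Step a b w → Adds b a d → w ≡ vweight d
  grow-weight (stay a≡b _)   s = ⊥-elim (adds-proper s a≡b)
  grow-weight (grow _ s′ w≡) s = trans w≡ (vweight-unique s′ s)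

  StepsAlong : ∀ {m} → (Fin (suc m) → List ℕ) → (Fin m → ℕ) → Set
  StepsAlong g w = ∀ k → Step (g (inject₁ k)) (g (fsuc k)) (w k)

  TrivialAt : ∀ {m} → (Fin (suc m) → List ℕ) → (Fin m → Bool) → Set
  TrivialAt g f = ∀ k → T (f k) → g (inject₁ k) ≡ g (fsuc k)

  same-domino : ∀ {κ ρ ν d} → IsPartition κ → IsPartition ρ → Adds κ ν d → Adds ρ ν d → κ ≡ ρ
  same-domino pκ pρ sκ sρ = partition-ext pκ pρ λ x → mk⇔ (transfer sκ sρ) (transfer sρ sκ)
    where
    transfer : ∀ {A B ν d x} → Adds A ν d → Adds B ν d → x ∈ᶜ A → x ∈ᶜ B
    transfer {ν = ν} {x = x} sA sB x∈A with ∈ᶜ-dec x ν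
    ... | yes x∈ν = adds-⊆ sB x x∈ν
    ... | no  x∉ν = proj₁ (domino-new sB (domino-fresh sA x∈A x∉ν))

  -- A new cell of B lying left of (resp. above) a new cell of A is in A, hence new for A.
  left-clash : ∀ {A B ν dA dB r c} → Adds A ν dA → Adds B ν dB →
               (r , suc c) ∈ᵈ dA → (r , c) ∈ᵈ dB → (r , c) ∈ᵈ dA
  left-clash {A} sA sB right∈dA x∈dB = new-in-both sA sB x∈dB
    (cell-left {A} (proj₁ (domino-new sA right∈dA)) (proj₁ (proj₂ (proj₁ (domino-new sB x∈dB)))))

  up-clash : ∀ {A B ν dA dB r c} → IsPartition A → Adds A ν dA → Adds B ν dB →
             (suc r , c) ∈ᵈ dA → (r , c) ∈ᵈ dB → (r , c) ∈ᵈ dA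
  up-clash {A} pA sA sB below∈dA x∈dB = new-in-both sA sB x∈dB
    (cell-up {A} pA (proj₁ (domino-new sA below∈dA)) (proj₁ (proj₁ (domino-new sB x∈dB))))

  overlap-hor-ver : ∀ {ν κ ρ r c r′ c′ p q} → IsPartition κ →
    Adds κ ν (hor r c) → Adds ρ ν (ver r′ c′) → (p , q) ∈ᵈ hor r c → (p , q) ∈ᵈ ver r′ c′ →
    hor r c ≡ hor p q × ver r′ c′ ≡ ver p q
  overlap-hor-ver _  _  _  (inj₁ refl) (inj₁ refl) = refl , refl
  overlap-hor-ver pκ sκ sρ (inj₁ refl) (inj₂ refl) =
    contradiction (up-clash pκ sκ sρ (inj₁ refl) (inj₁ refl)) λ { (inj₁ ()) ; (inj₂ ()) }
  overlap-hor-ver _  sκ sρ (inj₂ refl) (inj₁ refl) =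
    contradiction (left-clash sρ sκ (inj₁ refl) (inj₁ refl)) λ { (inj₁ ()) ; (inj₂ ()) }
  overlap-hor-ver _  sκ sρ (inj₂ refl) (inj₂ refl) =
    contradiction (left-clash sρ sκ (inj₂ refl) (inj₁ refl)) λ { (inj₁ ()) ; (inj₂ ()) }

  -- Distinct extensions of ν whose dominoes share the cell (p , q) are obtained by adding
  -- the horizontal and the vertical domino with corner (p , q): the configuration of rule (c).
  overlap-shape : ∀ {ν κ ρ d₁ d₂ p q} → IsPartition κ → IsPartition ρ →
    Adds κ ν d₁ → Adds ρ ν d₂ → κ ≢ ρ → (p , q) ∈ᵈ d₁ → (p , q) ∈ᵈ d₂ →
    (d₁ ≡ hor p q × d₂ ≡ ver p q) ⊎ (d₁ ≡ ver p q × d₂ ≡ hor p q)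
  overlap-shape {d₁ = hor _ _} {hor _ _} pκ pρ sκ sρ κ≢ρ (inj₁ refl) (inj₁ refl) =
    ⊥-elim (κ≢ρ (same-domino pκ pρ sκ sρ))
  overlap-shape {d₁ = hor _ _} {hor _ _} _ _ sκ sρ _ (inj₁ refl) (inj₂ refl) =
    contradiction (left-clash sκ sρ (inj₁ refl) (inj₁ refl)) λ { (inj₁ ()) ; (inj₂ ()) }
  overlap-shape {d₁ = hor _ _} {hor _ _} _ _ sκ sρ _ (inj₂ refl) (inj₁ refl) =
    contradiction (left-clash sρ sκ (inj₁ refl) (inj₁ refl)) λ { (inj₁ ()) ; (inj₂ ()) }
  overlap-shape {d₁ = hor _ _} {hor _ _} pκ pρ sκ sρ κ≢ρ (inj₂ refl) (inj₂ refl) =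
    ⊥-elim (κ≢ρ (same-domino pκ pρ sκ sρ))
  overlap-shape {d₁ = ver _ _} {ver _ _} pκ pρ sκ sρ κ≢ρ (inj₁ refl) (inj₁ refl) =
    ⊥-elim (κ≢ρ (same-domino pκ pρ sκ sρ))
  overlap-shape {d₁ = ver _ _} {ver _ _} pκ _ sκ sρ _ (inj₁ refl) (inj₂ refl) =
    contradiction (up-clash pκ sκ sρ (inj₁ refl) (inj₁ refl)) λ { (inj₁ ()) ; (inj₂ ()) }
  overlap-shape {d₁ = ver _ _} {ver _ _} _ pρ sκ sρ _ (inj₂ refl) (inj₁ refl) =
    contradiction (up-clash pρ sρ sκ (inj₁ refl) (inj₁ refl)) λ { (inj₁ ()) ; (inj₂ ()) }
  overlap-shape {d₁ = ver _ _} {ver _ _} pκ pρ sκ sρ κ≢ρ (inj₂ refl) (inj₂ refl) =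
    ⊥-elim (κ≢ρ (same-domino pκ pρ sκ sρ))
  overlap-shape {d₁ = hor _ _} {ver _ _} pκ _ sκ sρ _ m₁ m₂ = inj₁ (overlap-hor-ver pκ sκ sρ m₁ m₂)
  overlap-shape {d₁ = ver _ _} {hor _ _} _ pρ sκ sρ _ m₁ m₂ = inj₂ (swap-× (overlap-hor-ver pρ sρ sκ m₂ m₁))

  union-adds : ∀ {ν κ ρ γ d₁ d₂} → Adds κ ν d₁ → Adds ρ ν d₂ →
    (∀ x → x ∈ᵈ d₁ → ¬ x ∈ᵈ d₂) → γ ≐ (λ x → x ∈ᶜ κ ⊎ x ∈ᶜ ρ) → Adds γ ρ d₁
  union-adds {ν} {κ} {ρ} {γ} {d₁} sκ sρ disjoint γ≐ =
    adds ((λ x x∈ρ → from (γ≐ x) (inj₂ x∈ρ)) , λ x → mk⇔ (new x) (old x))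
    where
    new : ∀ x → x ∈ᶜ γ × ¬ x ∈ᶜ ρ → x ∈ᵈ d₁
    new x (x∈γ , x∉ρ) with to (γ≐ x) x∈γ
    ... | inj₁ x∈κ = domino-fresh sκ x∈κ (λ x∈ν → x∉ρ (adds-⊆ sρ x x∈ν))
    ... | inj₂ x∈ρ = ⊥-elim (x∉ρ x∈ρ)
    old : ∀ x → x ∈ᵈ d₁ → x ∈ᶜ γ × ¬ x ∈ᶜ ρ
    old x x∈d₁ = from (γ≐ x) (inj₁ (proj₁ (domino-new sκ x∈d₁))) ,
                 λ x∈ρ → disjoint x x∈d₁ (new-in-both sρ sκ x∈d₁ x∈ρ)

  -- The cell (p+1 , q+1) is not in ν, as its left neighbour (p+1 , q) is new for ρ.
  diagonal-new : ∀ {ν ρ p q} → Adds ρ ν (ver p q) → ¬ (suc p , suc q) ∈ᶜ ν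
  diagonal-new {ν} sρ diag∈ν = proj₂ (domino-new sρ (inj₂ refl))
    (cell-left {ν} diag∈ν (proj₁ (proj₂ (proj₁ (domino-new sρ (inj₁ refl))))))

  CornerFill : (κ ρ : List ℕ) → ℕ → ℕ → List ℕ → Set
  CornerFill κ ρ p q γ = γ ≐ (λ x → x ∈ᶜ κ ⊎ x ∈ᶜ ρ ⊎ x ≡ (suc p , suc q))

  corner-hor-step : ∀ {ν κ ρ γ p q} → Adds κ ν (hor p q) → Adds ρ ν (ver p q) →
                    CornerFill κ ρ p q γ → Adds γ κ (hor (suc p) q)
  corner-hor-step {ν} {κ} {ρ} {γ} {p} {q} sκ sρ γ≐ =
    adds ((λ x x∈κ → from (γ≐ x) (inj₁ x∈κ)) , λ x → mk⇔ (new x) (old x))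
    where
    new : ∀ x → x ∈ᶜ γ × ¬ x ∈ᶜ κ → x ∈ᵈ hor (suc p) q
    new x (x∈γ , x∉κ) with to (γ≐ x) x∈γ
    ... | inj₁ x∈κ          = ⊥-elim (x∉κ x∈κ)
    ... | inj₂ (inj₂ refl)  = inj₂ refl
    ... | inj₂ (inj₁ x∈ρ) with domino-fresh sρ x∈ρ (λ x∈ν → x∉κ (adds-⊆ sκ x x∈ν))
    ...   | inj₁ refl = ⊥-elim (x∉κ (proj₁ (domino-new sκ (inj₁ refl))))
    ...   | inj₂ refl = inj₁ refl
    old : ∀ x → x ∈ᵈ hor (suc p) q → x ∈ᶜ γ × ¬ x ∈ᶜ κ
    old _ (inj₁ refl) = from (γ≐ _) (inj₂ (inj₁ (proj₁ (domino-new sρ (inj₂ refl))))) ,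
      λ x∈κ → contradiction (new-in-both sκ sρ (inj₂ refl) x∈κ) λ { (inj₁ ()) ; (inj₂ ()) }
    old _ (inj₂ refl) = from (γ≐ _) (inj₂ (inj₂ refl)) ,
      λ x∈κ → contradiction (domino-fresh sκ x∈κ (diagonal-new sρ)) λ { (inj₁ ()) ; (inj₂ ()) }

  corner-ver-step : ∀ {ν κ ρ γ p q} → Adds κ ν (hor p q) → Adds ρ ν (ver p q) →
                    CornerFill κ ρ p q γ → Adds γ ρ (ver p (suc q))
  corner-ver-step {ν} {κ} {ρ} {γ} {p} {q} sκ sρ γ≐ =
    adds ((λ x x∈ρ → from (γ≐ x) (inj₂ (inj₁ x∈ρ))) , λ x → mk⇔ (new x) (old x))
    where
    new : ∀ x → x ∈ᶜ γ × ¬ x ∈ᶜ ρ → x ∈ᵈ ver p (suc q)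
    new x (x∈γ , x∉ρ) with to (γ≐ x) x∈γ
    ... | inj₂ (inj₁ x∈ρ)   = ⊥-elim (x∉ρ x∈ρ)
    ... | inj₂ (inj₂ refl)  = inj₂ refl
    ... | inj₁ x∈κ with domino-fresh sκ x∈κ (λ x∈ν → x∉ρ (adds-⊆ sρ x x∈ν))
    ...   | inj₁ refl = ⊥-elim (x∉ρ (proj₁ (domino-new sρ (inj₁ refl))))
    ...   | inj₂ refl = inj₁ refl
    old : ∀ x → x ∈ᵈ ver p (suc q) → x ∈ᶜ γ × ¬ x ∈ᶜ ρ
    old _ (inj₁ refl) = from (γ≐ _) (inj₁ (proj₁ (domino-new sκ (inj₂ refl)))) ,
      λ x∈ρ → contradiction (new-in-both sρ sκ (inj₂ refl) x∈ρ) λ { (inj₁ ()) ; (inj₂ ()) }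
    old _ (inj₂ refl) = from (γ≐ _) (inj₂ (inj₂ refl)) ,
      λ x∈ρ → contradiction (domino-fresh sρ x∈ρ (diagonal-new sρ)) λ { (inj₁ ()) ; (inj₂ ()) }

  -- Local balance at one cell of the growth diagram

  bar : Entry → ℕ
  bar zer = 0
  bar one = 0
  bar neg = 1

  -- For a cell with entry e, top step ν → κ of weight t and left step ν → ρ of weight l:
  -- the bottom step ρ → γ and the right step κ → γ have weights b , r with
  -- b + r = t + l + 2 · bar e.
  Balance : Entry → (κ ρ γ : List ℕ) → ℕ → ℕ → Set
  Balance e κ ρ γ t l = Σ ℕ λ b → Σ ℕ λ r → Step ρ γ b × Step κ γ r × b + r ≡ t + l + 2 * bar e

  -- Rules (b) and (c) are stated for the union in a fixed order; we need it in both.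
  ≐-reorder : ∀ {γ} {S S′ : Cell → Set} → (∀ {x} → S x → S′ x) → (∀ {x} → S′ x → S x) →
              γ ≐ S → γ ≐ S′
  ≐-reorder f g γ≐ x = mk⇔ (f ∘ to (γ≐ x)) (from (γ≐ x) ∘ g)

  -- Rules (d) and (e): both incoming steps add the same domino.
  balance-equal : ∀ {ν κ γ d₁ d₂} → Adds κ ν d₁ → Adds κ ν d₂ → LocalRule zer ν κ κ γ →
                  Balance zer κ κ γ (vweight d₁) (vweight d₂)
  balance-equal {d₁ = hor r c} sκ sκ′ (_ , _ , _ , _ , rule-d , _)
    rewrite sym (vweight-unique sκ sκ′) = 0 , 0 , step , step , refl
    where step = grow _ (adds (rule-d r c (Adds.skew sκ) refl)) refl
  balance-equal {d₁ = ver r c} sκ sκ′ (_ , _ , _ , _ , _ , rule-e)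
    rewrite sym (vweight-unique sκ sκ′) = 1 , 1 , step , step , refl
    where step = grow _ (adds (rule-e r c (Adds.skew sκ) refl)) refl

  -- Rules (b) and (c): the incoming steps add different dominoes.
  balance-distinct : ∀ {ν κ ρ γ d₁ d₂} → IsPartition κ → IsPartition ρ →
    Adds κ ν d₁ → Adds ρ ν d₂ → κ ≢ ρ → LocalRule zer ν κ ρ γ →
    Balance zer κ ρ γ (vweight d₁) (vweight d₂)
  balance-distinct {γ = γ} {d₁} {d₂} pκ pρ sκ sρ κ≢ρ (_ , _ , rule-b , rule-c , _)
    with meet? d₁ d₂
  ... | inj₁ disjoint =
    let γ≐ = rule-b d₁ d₂ (Adds.skew sκ) (Adds.skew sρ) κ≢ρ disjoint in
    _ , _ , grow d₁ (union-adds {γ = γ} sκ sρ disjoint γ≐) refl ,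
            grow d₂ (union-adds {γ = γ} sρ sκ (λ x x∈d₂ x∈d₁ → disjoint x x∈d₁ x∈d₂) (≐-reorder {γ} swap swap γ≐)) refl ,
            sym (ℕP.+-identityʳ _)
  ... | inj₂ ((p , q) , m₁ , m₂) with overlap-shape pκ pρ sκ sρ κ≢ρ m₁ m₂
  ...   | inj₁ (refl , refl) =
    let γ≐ = rule-c (hor p q) (ver p q) p q (Adds.skew sκ) (Adds.skew sρ) κ≢ρ m₁ m₂ in
    1 , 0 , grow _ (corner-ver-step sκ sρ γ≐) refl , grow _ (corner-hor-step sκ sρ γ≐) refl , refl
  ...   | inj₂ (refl , refl) =
    let γ≐ = ≐-reorder {γ} exchange exchange (rule-c (ver p q) (hor p q) p q (Adds.skew sκ) (Adds.skew sρ) κ≢ρ m₁ m₂) in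
    0 , 1 , grow _ (corner-hor-step sρ sκ γ≐) refl , grow _ (corner-ver-step sρ sκ γ≐) refl , refl
    where
    exchange : ∀ {A B C : Set} → A ⊎ (B ⊎ C) → B ⊎ (A ⊎ C)
    exchange = [ inj₂ ∘ inj₁ , [ inj₁ , inj₂ ∘ inj₂ ] ]

  -- Cells with entry 0: rule (a) when an incoming step is trivial, else (b)–(e).
  balance-zero : ∀ {ν κ ρ γ t l} → IsPartition κ → IsPartition ρ →
    Step ν κ t → Step ν ρ l → LocalRule zer ν κ ρ γ → Balance zer κ ρ γ t l
  balance-zero _ _ (stay refl refl) left (top-trivial , _) with top-trivial refl
  ... | refl = 0 , _ , stay refl refl , left , sym (ℕP.+-identityʳ _)
  balance-zero _ _ top@(grow _ _ _) (stay refl refl) (_ , left-trivial , _) with left-trivial refl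
  ... | refl = _ , 0 , top , stay refl refl , sym (ℕP.+-identityʳ _)
  balance-zero {κ = κ} {ρ} pκ pρ (grow _ sκ refl) (grow _ sρ refl) rule with ListP.≡-dec ℕ._≟_ κ ρ
  ... | yes refl = balance-equal sκ sρ rule
  ... | no  κ≢ρ  = balance-distinct pκ pρ sκ sρ κ≢ρ rule

  balance : ∀ e {ν κ ρ γ t l} → IsPartition κ → IsPartition ρ → Step ν κ t → Step ν ρ l →
            (T (nzB e) → ν ≡ κ × ν ≡ ρ) → LocalRule e ν κ ρ γ → Balance e κ ρ γ t l
  balance zer pκ pρ top left _ rule = balance-zero pκ pρ top left rule
  balance one _ _ top left trivial rule with trivial tt
  ... | refl , refl with stay-weight top | stay-weight left
  ...   | refl | refl = 0 , 0 , grow _ (adds rule) refl , grow _ (adds rule) refl , refl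
  balance neg _ _ top left trivial rule with trivial tt
  ... | refl , refl with stay-weight top | stay-weight left
  ...   | refl | refl = 1 , 1 , grow _ (adds rule) refl , grow _ (adds rule) refl , refl

  -- Summing the local balances

  zero-or-nonzero : ∀ e → e ≡ zer ⊎ T (nzB e)
  zero-or-nonzero zer = inj₁ refl
  zero-or-nonzero one = inj₂ tt
  zero-or-nonzero neg = inj₂ tt

  nonzero⇒≢ : ∀ {e} → T (nzB e) → e ≢ zer
  nonzero⇒≢ {one} _ ()
  nonzero⇒≢ {neg} _ ()

  anyFin-later : ∀ {n} (f : Fin (suc n) → Bool) → T (anyFin (f ∘ fsuc)) → T (anyFin f)
  anyFin-later f = from (T-∨ {f fzero}) ∘ inj₂

  anyFin-intro : ∀ {n} (f : Fin n → Bool) k → T (f k) → T (anyFin f)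
  anyFin-intro f fzero    = from (T-∨ {f fzero}) ∘ inj₁
  anyFin-intro f (fsuc k) = anyFin-later f ∘ anyFin-intro (f ∘ fsuc) k

  anyFin-witness : ∀ {n} (f : Fin n → Bool) → T (anyFin f) → ∃ λ k → T (f k)
  anyFin-witness {suc n} f any with to (T-∨ {f fzero}) any
  ... | inj₁ first = fzero , first
  ... | inj₂ later = let (k , kth) = anyFin-witness (f ∘ fsuc) later in fsuc k , kth

  pass-down : ∀ e {ν κ ρ γ} → e ≡ zer → LocalRule e ν κ ρ γ → ν ≡ κ → ρ ≡ γ
  pass-down .zer refl (top-trivial , _) ν≡κ = sym (top-trivial ν≡κ)

  pass-right : ∀ e {ν κ ρ γ} → e ≡ zer → LocalRule e ν κ ρ γ → ν ≡ ρ → κ ≡ γ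
  pass-right .zer refl (_ , left-trivial , _) ν≡ρ = sym (left-trivial ν≡ρ)

  RowRules : ∀ {m} → (Fin m → Entry) → (top bot : Fin (suc m) → List ℕ) → Set
  RowRules ent top bot =
    ∀ k → LocalRule (ent k) (top (inject₁ k)) (top (fsuc k)) (bot (inject₁ k)) (bot (fsuc k))

  AtMostOneNonzero : ∀ {m} → (Fin m → Entry) → Set
  AtMostOneNonzero ent = ∀ k k′ → ent k ≢ zer → ent k′ ≢ zer → k ≡ k′

  bars : ∀ {m} → (Fin m → Entry) → ℕ
  bars ent = sumFin (bar ∘ ent)

  row-arith : ∀ b₀ B r t₀ T l r₀ x y → b₀ + r₀ ≡ t₀ + l + 2 * x → B + r ≡ T + r₀ + 2 * y →
              b₀ + B + r ≡ t₀ + T + l + 2 * (x + y)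
  row-arith b₀ B r t₀ T l r₀ x y first rest = ℕP.+-cancelʳ-≡ r₀ _ _ (begin
    b₀ + B + r + r₀                      ≡⟨ regroup₁ b₀ B r r₀ ⟩
    (b₀ + r₀) + (B + r)                  ≡⟨ cong₂ _+_ first rest ⟩
    (t₀ + l + 2 * x) + (T + r₀ + 2 * y)  ≡⟨ regroup₂ t₀ l x T r₀ y ⟩
    t₀ + T + l + 2 * (x + y) + r₀        ∎)
    where
    open ≡-Reasoning
    regroup₁ : ∀ b₀ B r r₀ → b₀ + B + r + r₀ ≡ (b₀ + r₀) + (B + r)
    regroup₁ = solve-∀
    regroup₂ : ∀ t₀ l x T r₀ y → (t₀ + l + 2 * x) + (T + r₀ + 2 * y) ≡ t₀ + T + l + 2 * (x + y) + r₀
    regroup₂ = solve-∀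

  row-balance : ∀ m (top bot : Fin (suc m) → List ℕ) (ent : Fin m → Entry) {t : Fin m → ℕ} {l : ℕ} →
    (∀ k → IsPartition (top k)) → (∀ k → IsPartition (bot k)) →
    StepsAlong top t → TrivialAt top (nzB ∘ ent) →
    Step (top fzero) (bot fzero) l → (T (anyFin (nzB ∘ ent)) → top fzero ≡ bot fzero) →
    AtMostOneNonzero ent → RowRules ent top bot →
    Σ (Fin m → ℕ) λ b → Σ ℕ λ r →
      StepsAlong bot b × Step (top (fromℕ m)) (bot (fromℕ m)) r × sumFin b + r ≡ sumFin t + l + 2 * bars ent
  row-balance zero _ _ _ _ _ _ _ left _ _ _ = (λ ()) , _ , (λ ()) , left , sym (ℕP.+-identityʳ _)
  row-balance (suc m) top bot ent {t} {l} p-top p-bot top-steps top-trivial left left-trivial one-nonzero rules =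
    let b₀ , r₀ , bottom₀ , right₀ , first = balance (ent fzero) (p-top (fsuc fzero)) (p-bot fzero)
          (top-steps fzero) left (λ nz → top-trivial fzero nz , left-trivial (anyFin-intro (nzB ∘ ent) fzero nz))
          (rules fzero)
        b , r , bottom , right , rest = row-balance m (top ∘ fsuc) (bot ∘ fsuc) (ent ∘ fsuc)
          (p-top ∘ fsuc) (p-bot ∘ fsuc) (top-steps ∘ fsuc) (top-trivial ∘ fsuc) right₀ next-trivial
          (λ k k′ nz nz′ → FinP.suc-injective (one-nonzero (fsuc k) (fsuc k′) nz nz′)) (rules ∘ fsuc)
    in (λ { fzero → b₀ ; (fsuc k) → b k }) , r , (λ { fzero → bottom₀ ; (fsuc k) → bottom k }) , right ,
       row-arith b₀ (sumFin b) r (t fzero) (sumFin (t ∘ fsuc)) l r₀ (bar (ent fzero)) (bars (ent ∘ fsuc)) first rest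
    where
    -- a nonzero entry further right forces the first entry to be zero
    next-trivial : T (anyFin (nzB ∘ ent ∘ fsuc)) → top (fsuc fzero) ≡ bot (fsuc fzero)
    next-trivial later with zero-or-nonzero (ent fzero)
    ... | inj₁ first-zero =
      pass-right (ent fzero) first-zero (rules fzero) (left-trivial (anyFin-later (nzB ∘ ent) later))
    ... | inj₂ first-nz = let (k , kth) = anyFin-witness (nzB ∘ ent ∘ fsuc) later in
      contradiction (one-nonzero fzero (fsuc k) (nonzero⇒≢ first-nz) (nonzero⇒≢ kth)) λ ()

  GridRules : ∀ {n m} → Matrix n m → (Fin (suc n) → Fin (suc m) → List ℕ) → Set
  GridRules M Γ = ∀ i → RowRules (M i) (Γ (inject₁ i)) (Γ (fsuc i))

  matrix-bars : ∀ {n m} → Matrix n m → ℕ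
  matrix-bars M = sumFin (bars ∘ M)

  grid-arith : ∀ B R B₀ r₀ T l₀ L x y → B₀ + r₀ ≡ T + l₀ + 2 * x → B + R ≡ B₀ + L + 2 * y →
               B + (r₀ + R) ≡ T + (l₀ + L) + 2 * (x + y)
  grid-arith B R B₀ r₀ T l₀ L x y first rest = ℕP.+-cancelʳ-≡ B₀ _ _ (begin
    B + (r₀ + R) + B₀                    ≡⟨ regroup₁ B r₀ R B₀ ⟩
    (B₀ + r₀) + (B + R)                  ≡⟨ cong₂ _+_ first rest ⟩
    (T + l₀ + 2 * x) + (B₀ + L + 2 * y)  ≡⟨ regroup₂ T l₀ x B₀ L y ⟩
    T + (l₀ + L) + 2 * (x + y) + B₀      ∎)
    where
    open ≡-Reasoning
    regroup₁ : ∀ B r₀ R B₀ → B + (r₀ + R) + B₀ ≡ (B₀ + r₀) + (B + R)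
    regroup₁ = solve-∀
    regroup₂ : ∀ T l₀ x B₀ L y → (T + l₀ + 2 * x) + (B₀ + L + 2 * y) ≡ T + (l₀ + L) + 2 * (x + y) + B₀
    regroup₂ = solve-∀

  grid-balance : ∀ n m (Γ : Fin (suc n) → Fin (suc m) → List ℕ) (M : Matrix n m)
    {t : Fin m → ℕ} {l : Fin n → ℕ} → (∀ i k → IsPartition (Γ i k)) →
    StepsAlong (Γ fzero) t → TrivialAt (Γ fzero) (colNZ M) →
    StepsAlong (λ i → Γ i fzero) l → TrivialAt (λ i → Γ i fzero) (rowNZ M) →
    IsPPM M → GridRules M Γ →
    Σ (Fin m → ℕ) λ b → Σ (Fin n → ℕ) λ r →
      StepsAlong (Γ (fromℕ n)) b × StepsAlong (λ i → Γ i (fromℕ m)) r ×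
      sumFin b + sumFin r ≡ sumFin t + sumFin l + 2 * matrix-bars M
  grid-balance zero _ _ _ _ top _ _ _ _ _ = _ , (λ ()) , top , (λ ()) , sym (ℕP.+-identityʳ _)
  grid-balance (suc n) m Γ M {t} {l} p-Γ top top-trivial left left-trivial (rows-ppm , cols-ppm) rules =
    let b₀ , r₀ , bottom₀ , right₀ , first = row-balance m (Γ fzero) (Γ (fsuc fzero)) (M fzero)
          (p-Γ fzero) (p-Γ (fsuc fzero)) top (λ k nz → top-trivial k (anyFin-intro (λ i → nzB (M i k)) fzero nz))
          (left fzero) (left-trivial fzero) (rows-ppm fzero) (rules fzero)
        b , r , bottom , right , rest = grid-balance n m (Γ ∘ fsuc) (M ∘ fsuc) (p-Γ ∘ fsuc)
          bottom₀ next-trivial (left ∘ fsuc) (left-trivial ∘ fsuc)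
          (rows-ppm ∘ fsuc , λ i i′ k nz nz′ → FinP.suc-injective (cols-ppm (fsuc i) (fsuc i′) k nz nz′))
          (rules ∘ fsuc)
    in b , (λ { fzero → r₀ ; (fsuc i) → r i }) , bottom , (λ { fzero → right₀ ; (fsuc i) → right i }) ,
       grid-arith (sumFin b) (sumFin r) (sumFin b₀) r₀ (sumFin t) (l fzero) (sumFin (l ∘ fsuc))
         (bars (M fzero)) (matrix-bars (M ∘ fsuc)) first rest
    where
    -- a nonzero entry further down forces the entry of the first row to be zero
    next-trivial : TrivialAt (Γ (fsuc fzero)) (colNZ (M ∘ fsuc))
    next-trivial k later with zero-or-nonzero (M fzero k)
    ... | inj₁ first-zero = pass-down (M fzero k) first-zero (rules fzero k)
      (top-trivial k (anyFin-later (λ i → nzB (M i k)) later))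
    ... | inj₂ first-nz = let (i , ith) = anyFin-witness (λ i → nzB (M (fsuc i) k)) later in
      contradiction (cols-ppm fzero (fsuc i) k (nonzero⇒≢ first-nz) (nonzero⇒≢ ith)) λ ()

  -- The boundary of the growth diagram

  multichain-head : ∀ {γ b γ′ rest ds} → MultiChain γ ((b , γ′) ∷ rest) ds →
    Σ ℕ λ w → Step γ γ′ w × (T b → γ ≡ γ′) ×
      Σ (List Domino) λ ds′ → MultiChain γ′ rest ds′ × vcount ds ≡ w + vcount ds′
  multichain-head (stay chain)            = 0 , stay refl refl , (λ _ → refl) , _ , chain , refl
  multichain-head (grow {d = d} {ds = ds} s chain) =
    vweight d , grow d (adds s) refl , (λ ()) , ds , chain , vcount-∷ d ds

  multichain-steps : ∀ m (g : Fin (suc m) → List ℕ) (flag : Fin m → Bool) {ds} →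
    MultiChain (g fzero) (tabulate (λ k → flag k , g (fsuc k))) ds →
    Σ (Fin m → ℕ) λ w → StepsAlong g w × TrivialAt g flag × sumFin w ≡ vcount ds
  multichain-steps zero _ _ [] = (λ ()) , (λ ()) , (λ ()) , refl
  multichain-steps (suc m) g flag chain =
    let w₀ , step₀ , trivial₀ , ds′ , chain′ , count = multichain-head chain
        w , steps , trivial , count′ = multichain-steps m (g ∘ fsuc) (flag ∘ fsuc) chain′
    in (λ { fzero → w₀ ; (fsuc k) → w k }) , (λ { fzero → step₀ ; (fsuc k) → steps k }) ,
       (λ { fzero → trivial₀ ; (fsuc k) → trivial k }) , trans (cong (w₀ +_) count′) (sym count)

  diffs-head : ∀ {γ γ′ rest ds} → Diffs γ (γ′ ∷ rest) ds →
    Σ Domino λ d → Σ (List Domino) λ ds′ → Adds γ′ γ d × Diffs γ′ rest ds′ × vcount ds ≡ vweight d + vcount ds′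
  diffs-head (_∷_ {d = d} {ds = ds} s diffs) = d , ds , adds s , diffs , vcount-∷ d ds

  diffs-count : ∀ m (g : Fin (suc m) → List ℕ) {ds} {w : Fin m → ℕ} →
    Diffs (g fzero) (tabulate (g ∘ fsuc)) ds → StepsAlong g w → sumFin w ≡ vcount ds
  diffs-count zero _ [] _ = refl
  diffs-count (suc m) g diffs steps =
    let d , ds′ , s , diffs′ , count = diffs-head diffs
    in trans (cong₂ _+_ (grow-weight (steps fzero) s) (diffs-count m (g ∘ fsuc) diffs′ (steps ∘ fsuc)))
             (sym count)

  -- The -1 entries of M are the barred values of cp(M)

  sumFin-cong : ∀ {n} {f g : Fin n → ℕ} → (∀ i → f i ≡ g i) → sumFin f ≡ sumFin g
  sumFin-cong {zero}  _   = refl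
  sumFin-cong {suc n} f≡g = cong₂ _+_ (f≡g fzero) (sumFin-cong (f≡g ∘ fsuc))

  sumFin-zero : ∀ {n} {f : Fin n → ℕ} → (∀ i → f i ≡ 0) → sumFin f ≡ 0
  sumFin-zero {zero}  _    = refl
  sumFin-zero {suc n} f≡0 = cong₂ _+_ (f≡0 fzero) (sumFin-zero (f≡0 ∘ fsuc))

  positive-after : ∀ {j n} (r : Fin j → Fin (suc n)) → StrictlyIncreasing r →
                   ∀ {a b} → a <ᶠ b → r b ≢ fzero
  positive-after r inc {a} {b} a<b rb≡0 = ℕP.n≮0 (subst (λ x → toℕ (r a) < toℕ x) rb≡0 (inc a b a<b))

  lower : ∀ {j n} (r : Fin j → Fin (suc n)) → StrictlyIncreasing r → (∀ a → r a ≢ fzero) →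
          Σ (Fin j → Fin n) λ r′ → StrictlyIncreasing r′ × (∀ a → fsuc (r′ a) ≡ r a)
  lower {n = n} r inc nonzero = proj₁ ∘ pred , inc′ , proj₂ ∘ pred
    where
    pred′ : (x : Fin (suc n)) → x ≢ fzero → Σ (Fin n) λ y → fsuc y ≡ x
    pred′ fzero    x≢0 = ⊥-elim (x≢0 refl)
    pred′ (fsuc y) _   = y , refl
    pred = λ a → pred′ (r a) (nonzero a)
    inc′ : StrictlyIncreasing (proj₁ ∘ pred)
    inc′ a b a<b = ℕ.s<s⁻¹ (subst₂ (λ x y → toℕ x < toℕ y) (sym (proj₂ (pred a))) (sym (proj₂ (pred b)))
                                    (inc a b a<b))

  mutual
    reindex : ∀ {n j} (r : Fin j → Fin n) → StrictlyIncreasing r → (g : Fin n → ℕ) →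
              (∀ i → (∀ a → r a ≢ i) → g i ≡ 0) → sumFin g ≡ sumFin (g ∘ r)
    reindex {zero}  {zero}  _ _ _ _ = refl
    reindex {zero}  {suc _} r _ _ _ with r fzero
    ... | ()
    reindex {suc _} {zero}  _ _ g off = sumFin-zero (λ i → off i λ ())
    reindex {suc _} {suc _} r inc g off with r fzero FinP.≟ fzero
    ... | yes r0≡0 = cong₂ _+_ (cong g (sym r0≡0))
      (reindex-tail (r ∘ fsuc) (λ a b a<b → inc (fsuc a) (fsuc b) (s≤s a<b))
        (λ a → positive-after r inc {fzero} {fsuc a} (s≤s z≤n)) g
        (λ i missed → off (fsuc i) λ { fzero r0≡i → contradiction (trans (sym r0≡0) r0≡i) λ ()
                                     ; (fsuc a) → missed a }))
    ... | no  r0≢0 = cong₂ _+_ (off fzero nonzero) (reindex-tail r inc nonzero g (off ∘ fsuc))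
      where
      nonzero : ∀ a → r a ≢ fzero
      nonzero fzero    = r0≢0
      nonzero (fsuc a) = positive-after r inc {fzero} {fsuc a} (s≤s z≤n)

    reindex-tail : ∀ {n j} (r : Fin j → Fin (suc n)) → StrictlyIncreasing r → (∀ a → r a ≢ fzero) →
      (g : Fin (suc n) → ℕ) → (∀ i → (∀ a → r a ≢ fsuc i) → g (fsuc i) ≡ 0) →
      sumFin (g ∘ fsuc) ≡ sumFin (g ∘ r)
    reindex-tail r inc nonzero g off =
      let r′ , inc′ , lift = lower r inc nonzero in
      trans (reindex r′ inc′ (g ∘ fsuc)
               (λ i missed → off i λ a ra≡i → missed a (FinP.suc-injective (trans (lift a) ra≡i))))
            (sumFin-cong (cong g ∘ lift))

  perm-entry : ∀ {j} (π : ColoredPerm j) a →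
    permEntry π a (proj₁ (π a)) ≢ zer × bar (permEntry π a (proj₁ (π a))) ≡ (if proj₂ (π a) then 1 else 0)
  perm-entry π a with proj₁ (π a) FinP.≟ proj₁ (π a)
  ... | no  differs = ⊥-elim (differs refl)
  ... | yes _ with proj₂ (π a)
  ...   | true  = (λ ()) , refl
  ...   | false = (λ ()) , refl

  -- The -1 entries of M are counted by tc(cp M): deleting zero rows loses nothing, and each
  -- remaining row contributes 1 exactly when the corresponding value of π is barred.
  bars-of-cp : ∀ {j n m} (M : Matrix n m) → IsPPM M → (π : ColoredPerm j) → IsCp M π →
               matrix-bars M ≡ tc π
  bars-of-cp M (rows-ppm , _) π (r , c , r-inc , _ , kept-rows , _ , entries) =
    trans (reindex r r-inc (bars ∘ M) deleted-row) (sumFin-cong kept-row)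
    where
    deleted-row : ∀ i → (∀ a → r a ≢ i) → bars (M i) ≡ 0
    deleted-row i missed = sumFin-zero entry-zero
      where
      entry-zero : ∀ k → bar (M i k) ≡ 0
      entry-zero k with zero-or-nonzero (M i k)
      ... | inj₁ zero-entry = cong bar zero-entry
      ... | inj₂ nz = let a , ra≡i = to (kept-rows i) (anyFin-intro (λ k → nzB (M i k)) k nz) in
                      ⊥-elim (missed a ra≡i)
    kept-row : ∀ a → bars (M (r a)) ≡ (if proj₂ (π a) then 1 else 0)
    kept-row a = begin
      bars (M (r a))              ≡⟨ reindex (λ _ → c b) one-point (bar ∘ M (r a)) off-column ⟩
      bar (M (r a) (c b)) + 0     ≡⟨ ℕP.+-identityʳ _ ⟩
      bar (M (r a) (c b))         ≡⟨ cong bar (entries a b) ⟩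
      bar (permEntry π a b)       ≡⟨ proj₂ (perm-entry π a) ⟩
      (if proj₂ (π a) then 1 else 0) ∎
      where
      open ≡-Reasoning
      b = proj₁ (π a)
      one-point : StrictlyIncreasing {1} (λ _ → c b)
      one-point fzero fzero ()
      one-point _ (fsuc ()) _
      off-column : ∀ k → (∀ (_ : Fin 1) → c b ≢ k) → bar (M (r a) k) ≡ 0
      off-column k missed with zero-or-nonzero (M (r a) k)
      ... | inj₁ zero-entry = cong bar zero-entry
      ... | inj₂ nz = ⊥-elim (missed fzero (rows-ppm (r a) (c b) k
                        (λ e → proj₁ (perm-entry π a) (trans (sym (entries a b)) e)) (nonzero⇒≢ nz)))

  -- The combinatorial content of the proposition: #vert(P) + #vert(Q) = #vert(U) + #vert(V) + 2 tc(π).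
  -- It needs only the growth diagram, M being a partial permutation matrix, and π = cp(M).
  vertical-balance : ∀ {α β μ n m j U V P Q} {M : Matrix n m} {π : ColoredPerm j} →
    IsPPM M → IsΦ α β μ U V M P Q → IsCp M π →
    vcount P + vcount Q ≡ vcount U + vcount V + 2 * tc π
  vertical-balance {n = n} {m} {U = U} {V} {P} {Q} {M} {π} ppm
    (Γ , (p-Γ , Γ₀₀≡μ , _ , _ , chain-U , chain-V , rules) , diffs-P , diffs-Q) cp =
    let t , top , top-trivial , t≡U = multichain-steps m (Γ fzero) (colNZ M)
          (subst (λ γ → MultiChain γ _ U) (sym Γ₀₀≡μ) chain-U)
        l , left , left-trivial , l≡V = multichain-steps n (λ i → Γ i fzero) (rowNZ M)
          (subst (λ γ → MultiChain γ _ V) (sym Γ₀₀≡μ) chain-V)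
        b , r , bottom , right , balanced = grid-balance n m Γ M p-Γ top top-trivial left left-trivial ppm rules
    in begin
      vcount P + vcount Q
        ≡⟨ cong₂ _+_ (sym (diffs-count m (Γ (fromℕ n)) diffs-P bottom))
                     (sym (diffs-count n (λ i → Γ i (fromℕ m)) diffs-Q right)) ⟩
      sumFin b + sumFin r
        ≡⟨ balanced ⟩
      sumFin t + sumFin l + 2 * matrix-bars M
        ≡⟨ cong₂ _+_ (cong₂ _+_ t≡U l≡V) (cong (2 *_) (bars-of-cp M ppm π cp)) ⟩
      vcount U + vcount V + 2 * tc π ∎
    where open ≡-Reasoning

open VerticalBalance using (vertical-balance)
open import Data.Nat using (ℕ; _∸_)
import Data.Nat as ℕ
open import Data.List using (List; length)
open import Data.Integer using (ℤ; +_)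
import Data.Integer as ℤ
import Data.Integer.Properties as ℤP
open import Data.Integer.Tactic.RingSolver using (solve-∀)
open import Data.Rational using (ℚ; toℚᵘ; _/_; _+_; _-_)
open import Data.Rational.Properties using (toℚᵘ-injective; toℚᵘ-homo-+; toℚᵘ-fromℚᵘ)
import Data.Rational.Unnormalised as ℚᵘ
import Data.Rational.Unnormalised.Properties as ℚᵘP
open import Data.Rational.Solver using (module +-*-Solver)
open import Data.Product using (proj₁; _,_)
open import Relation.Binary.PropositionalEquality using (_≡_; refl; sym; trans; cong; cong₂; module ≡-Reasoning)

-- (+ a) / 2 is, by definition, the normalisation of the unnormalised fraction a / 2.
half : ℕ → ℚᵘ.ℚᵘ
half a = ℚᵘ.mkℚᵘ (+ a) 1

halves-+ : ∀ a b → (+ a) / 2 + (+ b) / 2 ≡ (+ (a ℕ.+ b)) / 2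
halves-+ a b = toℚᵘ-injective (begin
  toℚᵘ ((+ a) / 2 + (+ b) / 2)              ≈⟨ toℚᵘ-homo-+ ((+ a) / 2) ((+ b) / 2) ⟩
  toℚᵘ ((+ a) / 2) ℚᵘ.+ toℚᵘ ((+ b) / 2)  ≈⟨ ℚᵘP.+-cong (toℚᵘ-fromℚᵘ (half a)) (toℚᵘ-fromℚᵘ (half b)) ⟩
  half a ℚᵘ.+ half b                          ≈⟨ ℚᵘ.*≡* (trans (cross (+ a) (+ b)) (cong (ℤ._* (+ 2 ℤ.* + 2)) (sym (ℤP.pos-+ a b)))) ⟩
  half (a ℕ.+ b)                              ≈⟨ ℚᵘP.≃-sym (toℚᵘ-fromℚᵘ (half (a ℕ.+ b))) ⟩
  toℚᵘ ((+ (a ℕ.+ b)) / 2)                  ∎)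
  where
  open ℚᵘP.≃-Reasoning
  cross : ∀ (x y : ℤ) → (x ℤ.* + 2 ℤ.+ y ℤ.* + 2) ℤ.* + 2 ≡ (x ℤ.+ y) ℤ.* (+ 2 ℤ.* + 2)
  cross = solve-∀

half-double : ∀ t → (+ (2 ℕ.* t)) / 2 ≡ (+ t) / 1
half-double t = toℚᵘ-injective (begin
  toℚᵘ ((+ (2 ℕ.* t)) / 2)  ≈⟨ toℚᵘ-fromℚᵘ (half (2 ℕ.* t)) ⟩
  half (2 ℕ.* t)              ≈⟨ ℚᵘ.*≡* (trans (cong (ℤ._* + 1) (ℤP.pos-* 2 t)) (cross (+ t))) ⟩
  ℚᵘ.mkℚᵘ (+ t) 0             ≈⟨ ℚᵘP.≃-sym (toℚᵘ-fromℚᵘ (ℚᵘ.mkℚᵘ (+ t) 0)) ⟩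
  toℚᵘ ((+ t) / 1)          ∎)
  where
  open ℚᵘP.≃-Reasoning
  cross : ∀ (x : ℤ) → (+ 2 ℤ.* x) ℤ.* + 1 ≡ x ℤ.* + 2
  cross = solve-∀

halve-balance : ∀ a b c d t → a ℕ.+ b ≡ c ℕ.+ d ℕ.+ 2 ℕ.* t →
                (+ t) / 1 ≡ (+ a) / 2 + (+ b) / 2 - (+ c) / 2 - (+ d) / 2
halve-balance a b c d t balanced = begin
  t/1                              ≡⟨ sym (cancel c/2 d/2 t/1) ⟩
  c/2 + d/2 + t/1 - c/2 - d/2      ≡⟨ cong (λ z → z - c/2 - d/2) halves ⟩
  a/2 + b/2 - c/2 - d/2            ∎
  where
  open ≡-Reasoning
  a/2 = (+ a) / 2
  b/2 = (+ b) / 2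
  c/2 = (+ c) / 2
  d/2 = (+ d) / 2
  t/1 = (+ t) / 1
  cancel : ∀ (x y z : ℚ) → x + y + z - x - y ≡ z
  cancel = solve 3 (λ x y z → x :+ y :+ z :- x :- y := z) refl
    where open +-*-Solver
  halves : c/2 + d/2 + t/1 ≡ a/2 + b/2
  halves = begin
    c/2 + d/2 + t/1                           ≡⟨ cong₂ _+_ (halves-+ c d) (sym (half-double t)) ⟩
    (+ (c ℕ.+ d)) / 2 + (+ (2 ℕ.* t)) / 2     ≡⟨ halves-+ (c ℕ.+ d) (2 ℕ.* t) ⟩
    (+ (c ℕ.+ d ℕ.+ 2 ℕ.* t)) / 2             ≡⟨ cong (λ z → (+ z) / 2) (sym balanced) ⟩
    (+ (a ℕ.+ b)) / 2                         ≡⟨ sym (halves-+ a b) ⟩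
    a/2 + b/2                                 ∎

proposition3p6 : (α β μ : List ℕ) (n m j : ℕ) →
    IsPartition α → IsPartition β → IsPartition μ →
    (U : List Domino) → SDT μ β U → length U ≡ m ∸ j →
    (V : List Domino) → SDT μ α V → length V ≡ n ∸ j →
    (M : PPM j n m) →
    (P Q : List Domino) → IsΦ α β μ U V (proj₁ M) P Q →
    (π : ColoredPerm j) → IsColoredPerm π → IsCp (proj₁ M) π →
    (+ tc π) / 1 ≡ sp P + sp Q - sp U - sp V
proposition3p6 α β μ _ _ _ _ _ _ U _ _ V _ _ (M , ppm , _) P Q Φ π _ cp =
  halve-balance (vcount P) (vcount Q) (vcount U) (vcount V) (tc π)
    (vertical-balance {α = α} {β} {μ} {U = U} {V} {P} {Q} {π = π} ppm Φ cp)
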